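{- Let $F$ be a CNF formula with $m$ clauses and $(T,\delta)$ a decomposition tree of $I(F)$ of index $k$. For every node $z$ of $T$, $|\mathcal{R}_z|\le(m+1)^{2k}$.
   Context: A clause is a finite set of literals (variables $x$ or negations $\bar x$) not containing both $x$ and $\bar x$; a CNF formula $F$ is a finite set of clauses; $\mathrm{var}(C)$, $\mathrm{var}(F)$ denote occurring variables. The incidence graph $I(F)$ has vertex set $\mathrm{var}(F)\cup F$ and edges $Cx$ for $x\in\mathrm{var}(C)$. A decomposition tree of a graph $G=(V,E)$ is a pair $(T,\delta)$ with $T$ a rooted binary tree and $\delta$ a bijection from the leaves of $T$ to $V$. Each edge $e$ of $T$ induces a bipartition $(X,V\setminus X)$ where $X$ is the $\delta$-image of the leaves of one component of $T-e$. For proper nonempty $X\subseteq V$, $x\equiv_X y$ iff for all $w\in V\setminus X$: $xw\in E\Leftrightarrow yw\in E$; $\mathit{index}_G(X)$ is the number of classes of $\equiv_X$, $\iota_G(X)=\max(\mathit{index}_G(X),\mathit{index}_G(V\setminus X))$, and the index of $(T,\delta)$ is the maximum of $\iota_G(X)$ over bipartitions induced by edges of $T$. For a set of variables $X$, $2^X$ is the set of maps $\sigma:X\to\{0,1\}$ ($\sigma(\bar x)=1-\sigma(x)$); $\sigma$ satisfies $C$ if $\sigma(\ell)=1$ for some $\ell\in C$ with variable in $X$. For a set of clauses $G$, $G(\sigma)$ is the set of clauses of $G$ satisfied by $\sigma$, $\mathrm{Proj}(G,X)=\{G(\sigma):\sigma\in2^X\}$, and $G^{\supseteq X}=\{C\in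 G: X\subseteq\mathrm{var}(C)\}$. For a node $z$ of $T$ let $T_z$ be the subtree rooted at $z$ with leaf set $L(T_z)$; $\mathrm{var}_z=\mathrm{var}(F)\cap\delta(L(T_z))$, $F_z=F\cap\delta(L(T_z))$, $\overline{F_z}=F\setminus F_z$, $\overline{\mathrm{var}_z}=\mathrm{var}(F)\setminus\mathrm{var}_z$. A shape for $z$ is a pair $(\mathit{out},\mathit{in})$ with $\mathit{out}\subseteq\overline{F_z}$, $\mathit{in}\subseteq F_z$. Let $\mathcal{X}^{\uparrow}_z=\{X\subseteq\mathrm{var}_z:\exists C\in\overline{F_z},\ X=\mathrm{var}_z\cap\mathrm{var}(C)\}$ and $\mathcal{X}^{\downarrow}_z=\{X\subseteq\overline{\mathrm{var}_z}:\exists C\in F_z,\ X=\overline{\mathrm{var}_z}\cap\mathrm{var}(C)\}$. $\Phi_z$ is the set of functions $f$ with domain $\mathcal{X}^{\uparrow}_z$ with $f(X)\in\mathrm{Proj}(\overline{F_z}^{\supseteq X},X)$; $\Psi_z$ is the set of functions $g$ with domain $\mathcal{X}^{\downarrow}_z$ with $g(Y)\in\mathrm{Proj}(F_z^{\supseteq Y},Y)$. For such a function $h$, $\mathrm{union}(h)=\bigcup_{X\in\mathrm{dom}(h)}h(X)$. The set of restricted shapes is $\mathcal{R}_z=\{(\mathit{out},\mathit{in})\text{ shape for }z:\exists f\in\Phi_z,\ \mathit{out}=\mathrm{union}(f),\ \exists g\in\Psi_z,\ \mathit{in}=\mathrm{union}(g)\}$. -}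

module Defs where

open import Data.Nat using (ℕ; _⊔_)
open import Data.Bool using (Bool; true; false; not)
open import Data.Maybe using (Maybe; just; nothing)
open import Data.Fin using (Fin)
import Data.Fin.Properties as FinP
open import Data.Fin.Subset using (Subset; _∈_; _∉_)
open import Data.List using (List; []; _∷_; _++_; map; filter; length; foldr; deduplicate; allFin)
import Data.List.Properties as ListP
import Data.Bool.Properties as BoolP
open import Data.List.Relation.Unary.Any using (any?)
import Data.List.Membership.Propositional as MemP
open import Data.Sum using (_⊎_; inj₁; inj₂)
import Data.Sum.Properties as SumP
open import Data.Product using (Σ; ∃; _×_; _,_)
open import Data.Empty using (⊥)
open import Data.Unit using (⊤)
open import Relation.Nullary using (¬_; Dec; yes; no)
open import Relation.Nullary.Decidable using (⌊_⌋; ¬?)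
open import Relation.Binary.PropositionalEquality using (_≡_; _≢_)
open import Function.Bundles using (_⇔_)

-- Variables range over Fin n (a universe of variable names; var(F) is the
-- set of those that actually occur).  A clause is a map assigning to each
-- variable: nothing (does not occur), just true (literal x occurs),
-- just false (literal x̄ occurs).  This rules out clauses containing both
-- x and x̄.  A formula with m clauses is an injective family of m clauses
-- (F is a *set* of clauses, so clauses are pairwise distinct).

Clause : ℕ → Set
Clause n = Fin n → Maybe Bool

record CNF (n m : ℕ) : Set where
  field
    clause   : Fin m → Clause n
    distinct : ∀ i j → (∀ x → clause i x ≡ clause j x) → i ≡ j
open CNF public

module _ {n m : ℕ} (F : CNF n m) where

  InClause : Fin m → Fin n → Set
  InClause C x = clause F C x ≢ nothing

  inClause? : Fin m → Fin n → Bool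
  inClause? C x with clause F C x
  ... | nothing = false
  ... | just _  = true

  Occurs : Fin n → Set
  Occurs x = ∃ λ C → InClause C x

  occurs? : Fin n → Bool
  occurs? x = foldr (λ C b → Data.Bool._∨_ (inClause? C x) b) false (allFin m)

-- The incidence graph I(F).  Vertices are taken from Fin n ⊎ Fin m
-- (inj₁ x = variable x, inj₂ C = clause C); the actual vertex set is
-- var(F) ⊎ F.

Vertex : ℕ → ℕ → Set
Vertex n m = Fin n ⊎ Fin m

_≟V_ : ∀ {n m} → (u v : Vertex n m) → Dec (u ≡ v)
_≟V_ = SumP.≡-dec FinP._≟_ FinP._≟_

module _ {n m : ℕ} (F : CNF n m) where

  IsVertex : Vertex n m → Set
  IsVertex (inj₁ x) = Occurs F x
  IsVertex (inj₂ C) = ⊤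

  vertexList : List (Vertex n m)
  vertexList = map inj₁ (filter (λ x → occurs? F x Data.Bool.≟ true) (allFin n))
               ++ map inj₂ (allFin m)

  adj : Vertex n m → Vertex n m → Bool
  adj (inj₁ x) (inj₂ C) = inClause? F C x
  adj (inj₂ C) (inj₁ x) = inClause? F C x
  adj _ _ = false

data Tree (n m : ℕ) : Set where
  leaf : Vertex n m → Tree n m
  node : Tree n m → Tree n m → Tree n m

leaves : ∀ {n m} → Tree n m → List (Vertex n m)
leaves (leaf v)   = v ∷ []
leaves (node l r) = leaves l ++ leaves r

open import Data.List.Relation.Unary.Unique.Propositional using (Unique)

-- δ is a bijection from the leaves of T onto the vertex set of I(F)
IsDecompTree : ∀ {n m} → CNF n m → Tree n m → Set
IsDecompTree F T =
  Unique (leaves T) × (∀ v → MemP._∈_ v (leaves T) ⇔ IsVertex F v)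

-- nodes of T (identified with the subtrees T_z rooted at them)
data _⊑_ {n m : ℕ} : Tree n m → Tree n m → Set where
  here  : ∀ {t} → t ⊑ t
  left  : ∀ {z l r} → z ⊑ l → z ⊑ node l r
  right : ∀ {z l r} → z ⊑ r → z ⊑ node l r

-- the non-root nodes of T; each corresponds to the edge to its parent
nonRootNodes : ∀ {n m} → Tree n m → List (Tree n m)
nonRootNodes (leaf v)   = []
nonRootNodes (node l r) = l ∷ r ∷ (nonRootNodes l ++ nonRootNodes r)

module _ {n m : ℕ} (F : CNF n m) where

  complement : List (Vertex n m) → List (Vertex n m)
  complement X = filter (λ v → ¬? (any? (λ u → v ≟V u) X)) (vertexList F)

  -- index_G(X): number of classes of ≡_X.  x ≡_X y iff x and y have the
  -- same adjacency vector towards V \ X, so we count distinct vectors.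
  indexG : List (Vertex n m) → ℕ
  indexG X = length (deduplicate (ListP.≡-dec BoolP._≟_)
                       (map (λ x → map (adj F x) (complement X)) X))

  ι : List (Vertex n m) → ℕ
  ι X = indexG X ⊔ indexG (complement X)

  -- index of (T, δ): maximum of ι over bipartitions induced by edges of T
  -- (the bipartition of the edge above a non-root node z is
  --  (δ(L(T_z)), V \ δ(L(T_z)))); 0 if T has no edges.
  treeIndex : Tree n m → ℕ
  treeIndex T = foldr _⊔_ 0 (map (λ z → ι (leaves z)) (nonRootNodes T))

module _ {n m : ℕ} (F : CNF n m) (z : Tree n m) where

  VarZ : Fin n → Set
  VarZ x = MemP._∈_ (inj₁ x) (leaves z)

  VarZbar : Fin n → Set
  VarZbar x = Occurs F x × ¬ VarZ x

  FZ : Fin m → Set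
  FZ C = MemP._∈_ (inj₂ C) (leaves z)

  -- σ ∈ 2^X satisfies C (σ is given on all variables; only its values on X
  -- matter): some literal of C with variable in X is set to 1 by σ
  SatOn : Subset n → (Fin n → Bool) → Fin m → Set
  SatOn X σ C = ∃ λ x → x ∈ X × ∃ λ b → clause F C x ≡ just b × σ x ≡ b

  -- S ∈ Proj(G^{⊇X}, X), where G is given as a predicate on clauses
  InProjSup : (Fin m → Set) → Subset n → Subset m → Set
  InProjSup G X S = ∃ λ (σ : Fin n → Bool) → ∀ C →
    (C ∈ S) ⇔ ((G C × (∀ x → x ∈ X → InClause F C x)) × SatOn X σ C)

  XUp : Subset n → Set
  XUp X = ∃ λ C → ¬ FZ C × (∀ x → (x ∈ X) ⇔ (VarZ x × InClause F C x))

  XDown : Subset n → Set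
  XDown Y = ∃ λ C → FZ C × (∀ x → (x ∈ Y) ⇔ (VarZbar x × InClause F C x))

  -- f ∈ Φ_z (f is total on Subset n; only its values on 𝒳↑_z matter)
  InΦ : (Subset n → Subset m) → Set
  InΦ f = ∀ X → XUp X → InProjSup (λ C → ¬ FZ C) X (f X)

  InΨ : (Subset n → Subset m) → Set
  InΨ g = ∀ Y → XDown Y → InProjSup FZ Y (g Y)

  IsUnion : (Subset n → Set) → (Subset n → Subset m) → Subset m → Set
  IsUnion D h S = ∀ C → (C ∈ S) ⇔ (∃ λ X → D X × C ∈ h X)

  Shape : Set
  Shape = Subset m × Subset m

  -- (out, in) ∈ ℛ_z
  RestrictedShape : Shape → Set
  RestrictedShape (out , inn) =
    (∀ C → C ∈ out → ¬ FZ C) × (∀ C → C ∈ inn → FZ C) ×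
    (∃ λ f → InΦ f × IsUnion XUp f out) ×
    (∃ λ g → InΨ g × IsUnion XDown g inn)

-- For X ∈ 𝒳↑_z the projection Proj(G^{⊇X}, X) has at most m + 1 elements: if σ satisfies
-- every clause of G^{⊇X} the projection is G^{⊇X} itself, and otherwise, for a clause C′
-- falsified by σ, it consists of the clauses of G^{⊇X} that disagree with C′ on X, since
-- two clauses containing all of X that are both falsified by σ agree on X.  Hence the sets
-- union(f), f ∈ Φ_z, number at most (m + 1)^|𝒳↑_z|.  Each X ∈ 𝒳↑_z is the neighbourhood
-- inside var_z of a clause outside F_z, so it is determined by the ≡-class of that clause
-- for the bipartition of the edge above z, and |𝒳↑_z| ≤ k.  Symmetrically for the sets
-- union(g), g ∈ Ψ_z.  At the root no clause lies outside F_z and every Y ∈ 𝒳↓_z is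
-- empty, so there is just one shape.
module Submission where

open import Defs
open import Data.Nat using (ℕ; suc; _*_; _^_; _≤_)
open import Data.Fin.Subset using (Subset)
open import Data.Product using (_×_)
open import Data.List using (List; length)
open import Data.List.Relation.Unary.All using (All; []; _∷_)
open import Data.List.Relation.Unary.Unique.Propositional using (Unique)

open import Data.Nat using (_+_; _⊔_; z≤n; s≤s; NonZero)
open import Data.Nat.Properties
  using (≤-refl; ≤-trans; ≤-reflexive; m≤m⊔n; m≤n⊔m; *-mono-≤; ^-monoʳ-≤; ^-distribˡ-+-*;
         +-identityʳ; module ≤-Reasoning)
open import Data.Bool using (Bool; true; false; not; _∨_)
import Data.Bool.Properties as Bool
open import Data.Maybe using (Maybe; just; nothing)
import Data.Maybe.Properties as Maybe
open import Data.Fin using (Fin)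
open import Data.Fin.Properties using (any?; all?)
open import Data.Fin.Subset using (_∈_; _∪_; ⋃; ⁅_⁆; Empty) renaming (⊥ to ∅)
open import Data.Fin.Subset.Properties using (_∈?_; ⊆-antisym; ∉⊥; x∈p∪q⁻; x∈p∪q⁺; x∈⁅y⁆⇔x≡y)
open import Data.Vec using (tabulate)
open import Data.Vec.Properties using (lookup∘tabulate; []=⇒lookup; lookup⇒[]=)
open import Data.List
  using ([]; _∷_; _++_; map; filter; cartesianProductWith; deduplicate; allFin; foldr)
open import Data.List.Properties
  using (length-++; length-map; length-tabulate; length-filter; length-removeAt′)
import Data.List.Properties as List
open import Data.List.Relation.Unary.Any using (here; there; index; _─_)
import Data.List.Relation.Unary.Any as Any
import Data.List.Relation.Unary.All as All
open import Data.List.Relation.Unary.All.Properties using (all-filter)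
open import Data.List.Relation.Unary.AllPairs using (_∷_)
open import Data.List.Membership.Propositional using () renaming (_∈_ to _∈ₗ_; _∉_ to _∉ₗ_)
open import Data.List.Membership.Propositional.Properties
  using (∈-map⁺; ∈-map⁻; ∈-filter⁺; ∈-filter⁻; ∈-deduplicate⁺; ∈-allFin; ∈-++⁺ˡ; ∈-++⁺ʳ;
         ∈-cartesianProductWith⁺)
open import Data.Sum using (_⊎_; inj₁; inj₂)
open import Data.Product using (∃; ∃₂; _,_; proj₁; proj₂)
open import Data.Empty using (⊥-elim)
open import Data.Unit using (tt)
open import Function using (_∘_; case_of_)
open import Function.Construct.Identity using (⇔-id)
open import Function.Construct.Composition using (_⇔-∘_)
open import Function.Construct.Symmetry using (⇔-sym)
open import Data.Product.Function.NonDependent.Propositional using (_×-⇔_)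
open import Function.Bundles using (_⇔_; mk⇔; Equivalence)
open Equivalence using (to; from)
open import Relation.Nullary using (¬_; Dec; yes; no)
open import Relation.Nullary.Decidable
  using (⌊_⌋; _×-dec_; _→-dec_; ¬?; map′; decidable-stable; toWitness; fromWitness)
open import Relation.Unary using (Decidable)
open import Relation.Binary.PropositionalEquality
  using (_≡_; _≢_; refl; sym; trans; cong; cong₂; subst)
open import Relation.Binary.PropositionalEquality.Properties using (module ≡-Reasoning)

record AtMost {A : Set} (b : ℕ) (P : A → Set) : Set where
  field
    candidates : List A
    length≤    : length candidates ≤ b
    complete   : ∀ {x} → P x → x ∈ₗ candidates
open AtMost

module _ {A : Set} where

  ∈-─ : ∀ {x y : A} {xs} (x∈xs : x ∈ₗ xs) → y ∈ₗ xs → y ≢ x → y ∈ₗ (xs ─ x∈xs)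
  ∈-─ (here refl) (here refl) y≢x = ⊥-elim (y≢x refl)
  ∈-─ (here _)    (there y∈xs) _  = y∈xs
  ∈-─ (there _)   (here refl) _   = here refl
  ∈-─ (there x∈xs) (there y∈xs) y≢x = there (∈-─ x∈xs y∈xs y≢x)

  unique-⊆⇒length≤ : ∀ {xs ys : List A} → Unique xs → (∀ {x} → x ∈ₗ xs → x ∈ₗ ys) →
                     length xs ≤ length ys
  unique-⊆⇒length≤ {[]}     _              _     = z≤n
  unique-⊆⇒length≤ {x ∷ xs} {ys} (x∉xs ∷ u) xs⊆ys = begin
    suc (length xs)           ≤⟨ s≤s (unique-⊆⇒length≤ u xs⊆ys─x) ⟩
    suc (length (ys ─ x∈ys))  ≡⟨ sym (length-removeAt′ ys (index x∈ys)) ⟩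
    length ys                 ∎
    where
    open ≤-Reasoning
    x∈ys = xs⊆ys (here refl)
    xs⊆ys─x : ∀ {y} → y ∈ₗ xs → y ∈ₗ (ys ─ x∈ys)
    xs⊆ys─x y∈xs = ∈-─ x∈ys (xs⊆ys (there y∈xs)) (λ y≡x → All.lookup x∉xs y∈xs (sym y≡x))

  atMost⇒length≤ : ∀ {b P} → AtMost b P → ∀ {xs} → Unique xs → All P xs → length xs ≤ b
  atMost⇒length≤ bound u all =
    ≤-trans (unique-⊆⇒length≤ u (complete bound ∘ All.lookup all)) (length≤ bound)

  AtMost-weaken : ∀ {a b} {P : A → Set} → a ≤ b → AtMost a P → AtMost b P
  AtMost-weaken a≤b bound = record
    { candidates = candidates bound
    ; length≤    = ≤-trans (length≤ bound) a≤b
    ; complete   = complete bound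
    }

  AtMost-⊆ : ∀ {b} {P Q : A → Set} → (∀ {x} → P x → Q x) → AtMost b Q → AtMost b P
  AtMost-⊆ P⊆Q bound = record
    { candidates = candidates bound
    ; length≤    = length≤ bound
    ; complete   = complete bound ∘ P⊆Q
    }

length-cartesianProductWith : ∀ {A B C : Set} (f : A → B → C) xs ys →
  length (cartesianProductWith f xs ys) ≡ length xs * length ys
length-cartesianProductWith f []       ys = refl
length-cartesianProductWith f (x ∷ xs) ys = begin
  length (map (f x) ys ++ cartesianProductWith f xs ys)
    ≡⟨ length-++ (map (f x) ys) ⟩
  length (map (f x) ys) + length (cartesianProductWith f xs ys)
    ≡⟨ cong₂ _+_ (length-map (f x) ys) (length-cartesianProductWith f xs ys) ⟩
  length ys + length xs * length ys
    ∎
  where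
  open ≡-Reasoning

AtMost-map₂ : ∀ {A B C : Set} {a b} {P : A → Set} {Q : B → Set} (f : A → B → C) →
  AtMost a P → AtMost b Q → AtMost (a * b) (λ c → ∃₂ λ x y → P x × Q y × c ≡ f x y)
AtMost-map₂ f boundP boundQ = record
  { candidates = cartesianProductWith f (candidates boundP) (candidates boundQ)
  ; length≤    = ≤-trans (≤-reflexive (length-cartesianProductWith f (candidates boundP)
                                                                      (candidates boundQ)))
                         (*-mono-≤ (length≤ boundP) (length≤ boundQ))
  ; complete   = λ { (x , y , Px , Qy , refl) →
                     ∈-cartesianProductWith⁺ f (complete boundP Px) (complete boundQ Qy) }
  }

module _ {n : ℕ} where

  ⇔⇒≡ : {p q : Subset n} → (∀ x → x ∈ p ⇔ x ∈ q) → p ≡ q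
  ⇔⇒≡ p⇔q = ⊆-antisym (λ {x} → to (p⇔q x)) (λ {x} → from (p⇔q x))

  ∈-tabulate : ∀ (f : Fin n → Bool) x → x ∈ tabulate f ⇔ f x ≡ true
  ∈-tabulate f x = mk⇔ (λ x∈ → trans (sym (lookup∘tabulate f x)) ([]=⇒lookup x∈))
                       (λ fx → lookup⇒[]= x _ (trans (lookup∘tabulate f x) fx))

  ∈-tabulate-⌊⌋ : ∀ {P : Fin n → Set} (P? : Decidable P) x → x ∈ tabulate (⌊_⌋ ∘ P?) ⇔ P x
  ∈-tabulate-⌊⌋ P? x = mk⇔ (toWitness {a? = P? x} ∘ from Bool.T-≡ ∘ to ∈tab)
                           (from ∈tab ∘ to Bool.T-≡ ∘ fromWitness {a? = P? x})
    where
    ∈tab = ∈-tabulate (⌊_⌋ ∘ P?) x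

  ∈-⋃⁺ : ∀ {x p} {ps : List (Subset n)} → p ∈ₗ ps → x ∈ p → x ∈ ⋃ ps
  ∈-⋃⁺ (here refl) x∈p = x∈p∪q⁺ (inj₁ x∈p)
  ∈-⋃⁺ (there p∈ps) x∈p = x∈p∪q⁺ (inj₂ (∈-⋃⁺ p∈ps x∈p))

  ∈-⋃⁻ : ∀ {x} (ps : List (Subset n)) → x ∈ ⋃ ps → ∃ λ p → p ∈ₗ ps × x ∈ p
  ∈-⋃⁻ []       x∈∅ = ⊥-elim (∉⊥ x∈∅)
  ∈-⋃⁻ (p ∷ ps) x∈⋃ with x∈p∪q⁻ p (⋃ ps) x∈⋃
  ... | inj₁ x∈p = p , here refl , x∈p
  ... | inj₂ x∈⋃ps = let (q , q∈ps , x∈q) = ∈-⋃⁻ ps x∈⋃ps in q , there q∈ps , x∈q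

⋃-choices-atMost : ∀ {A : Set} {m b} (Q : A → Subset m → Set) → (∀ U → AtMost b (Q U)) →
  (Us : List A) →
  AtMost (b ^ length Us) (λ S → ∃ λ h → All (λ U → Q U (h U)) Us × S ≡ ⋃ (map h Us))
⋃-choices-atMost Q bound [] = record
  { candidates = ∅ ∷ [] ; length≤ = ≤-refl ; complete = λ { (_ , [] , refl) → here refl } }
⋃-choices-atMost Q bound (U ∷ Us) =
  AtMost-⊆ split (AtMost-map₂ _∪_ (bound U) (⋃-choices-atMost Q bound Us))
  where
  split : ∀ {S} → (∃ λ h → All (λ U → Q U (h U)) (U ∷ Us) × S ≡ ⋃ (map h (U ∷ Us))) →
          ∃₂ λ S₁ S₂ → Q U S₁ × (∃ λ h → All (λ U → Q U (h U)) Us × S₂ ≡ ⋃ (map h Us)) ×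
                       S ≡ S₁ ∪ S₂
  split (h , QU ∷ QUs , refl) = h U , ⋃ (map h Us) , QU , (h , QUs , refl) , refl

-- Members X of D whose choices in P X are all empty contribute nothing to a union of
-- choices, so a cover may omit them.
record Cover {n m : ℕ} (k : ℕ) (D : Subset n → Set) (P : Subset n → Subset m → Set) : Set where
  field
    members  : List (Subset n)
    length≤  : length members ≤ k
    sound    : All D members
    complete : ∀ X → D X → X ∈ₗ members ⊎ (∀ S → P X S → Empty S)
open Cover

module _ {n m : ℕ} (F : CNF n m) (z : Tree n m) where

  Unions : (Subset n → Set) → (Subset n → Subset m → Set) → Subset m → Set
  Unions D P S = ∃ λ h → (∀ X → D X → P X (h X)) × IsUnion F z D h S

  module _ {k} {D : Subset n → Set} {P : Subset n → Subset m → Set} (cover : Cover k D P) where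

    isUnion⇒≡⋃ : ∀ {h S} → (∀ X → D X → P X (h X)) → IsUnion F z D h S →
                 S ≡ ⋃ (map h (members cover))
    isUnion⇒≡⋃ {h} {S} hP S≡⋃h = ⇔⇒≡ λ C → mk⇔ (fromS C) (toS C)
      where
      fromS : ∀ C → C ∈ S → C ∈ ⋃ (map h (members cover))
      fromS C C∈S with to (S≡⋃h C) C∈S
      ... | X , DX , C∈hX with complete cover X DX
      ...   | inj₁ X∈members = ∈-⋃⁺ (∈-map⁺ h X∈members) C∈hX
      ...   | inj₂ trivial   = ⊥-elim (trivial (h X) (hP X DX) (C , C∈hX))
      toS : ∀ C → C ∈ ⋃ (map h (members cover)) → C ∈ S
      toS C C∈⋃ with ∈-⋃⁻ (map h (members cover)) C∈⋃
      ... | _ , p∈ , C∈p with ∈-map⁻ h p∈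
      ...   | X , X∈members , refl = from (S≡⋃h C) (X , All.lookup (sound cover) X∈members , C∈p)

    unions-atMost : ∀ {b} .{{_ : NonZero b}} → (∀ X → AtMost b (P X)) →
                    AtMost (b ^ k) (Unions D P)
    unions-atMost {b} bound =
      AtMost-weaken (^-monoʳ-≤ b (length≤ cover))
        (AtMost-⊆ asChoices (⋃-choices-atMost P bound (members cover)))
      where
      asChoices : ∀ {S} → Unions D P S →
                  ∃ λ h → All (λ U → P U (h U)) (members cover) × S ≡ ⋃ (map h (members cover))
      asChoices (h , hP , S≡⋃h) = h , All.map (hP _) (sound cover) , isUnion⇒≡⋃ hP S≡⋃h

≢nothing-≢just⇒≡just-not : ∀ (v : Maybe Bool) {b} → v ≢ nothing → v ≢ just b → v ≡ just (not b)
≢nothing-≢just⇒≡just-not nothing      v≢nothing _ = ⊥-elim (v≢nothing refl)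
≢nothing-≢just⇒≡just-not (just false) {false} _ v≢b = ⊥-elim (v≢b refl)
≢nothing-≢just⇒≡just-not (just false) {true}  _ _   = refl
≢nothing-≢just⇒≡just-not (just true)  {false} _ _   = refl
≢nothing-≢just⇒≡just-not (just true)  {true}  _ v≢b = ⊥-elim (v≢b refl)

inClause-dec : ∀ {n m} (F : CNF n m) C → Decidable (InClause F C)
inClause-dec F C x = ¬? (Maybe.≡-dec Bool._≟_ (clause F C x) nothing)

module Projection {n m} (F : CNF n m) (z : Tree n m)
                  {G : Fin m → Set} (G? : Decidable G) (X : Subset n) where

  G⊇X : Fin m → Set
  G⊇X C = G C × (∀ x → x ∈ X → InClause F C x)

  G⊇X? : Decidable G⊇X
  G⊇X? C = G? C ×-dec all? (λ x → x ∈? X →-dec inClause-dec F C x)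

  satOn? : ∀ σ → Decidable (SatOn F z X σ)
  satOn? σ C = map′ (λ (x , x∈X , Cx≡σx) → x , x∈X , σ x , Cx≡σx , refl)
                    (λ (x , x∈X , b , Cx≡b , σx≡b) → x , x∈X , trans Cx≡b (cong just (sym σx≡b)))
                    (any? λ x → x ∈? X ×-dec Maybe.≡-dec Bool._≟_ (clause F C x) (just (σ x)))

  AgreeOnX : Fin m → Fin m → Set
  AgreeOnX C C′ = ∀ x → x ∈ X → clause F C x ≡ clause F C′ x

  agreeOnX? : ∀ C C′ → Dec (AgreeOnX C C′)
  agreeOnX? C C′ = all? λ x → x ∈? X →-dec Maybe.≡-dec Bool._≟_ (clause F C x) (clause F C′ x)

  -- σ falsifies a clause containing all of X exactly when the clause takes the value
  -- not (σ x) at every x ∈ X, so all such falsified clauses agree on X.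
  falsified⇒agreeOnX : ∀ {σ C C′} → G⊇X C → G⊇X C′ →
    ¬ SatOn F z X σ C → ¬ SatOn F z X σ C′ → AgreeOnX C C′
  falsified⇒agreeOnX {σ} {C} {C′} (_ , X⊆C) (_ , X⊆C′) ¬satC ¬satC′ x x∈X =
    trans (falsifiedAt X⊆C ¬satC) (sym (falsifiedAt X⊆C′ ¬satC′))
    where
    falsifiedAt : ∀ {D} → (∀ x → x ∈ X → InClause F D x) → ¬ SatOn F z X σ D →
                  clause F D x ≡ just (not (σ x))
    falsifiedAt X⊆D ¬satD = ≢nothing-≢just⇒≡just-not _ (X⊆D x x∈X)
                              (λ Dx≡σx → ¬satD (x , x∈X , σ x , Dx≡σx , refl))

  agreeOnX-falsified : ∀ {σ C C′} → AgreeOnX C C′ → ¬ SatOn F z X σ C′ → ¬ SatOn F z X σ C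
  agreeOnX-falsified C≈C′ ¬satC′ (x , x∈X , b , Cx≡b , σx≡b) =
    ¬satC′ (x , x∈X , b , trans (sym (C≈C′ x x∈X)) Cx≡b , σx≡b)

  DisagreeWith : Fin m → Fin m → Set
  DisagreeWith C′ C = G⊇X C × ¬ AgreeOnX C C′

  disagreeWith? : ∀ C′ → Decidable (DisagreeWith C′)
  disagreeWith? C′ C = G⊇X? C ×-dec ¬? (agreeOnX? C C′)

  projections : List (Subset m)
  projections = tabulate (⌊_⌋ ∘ G⊇X?) ∷ map (λ C′ → tabulate (⌊_⌋ ∘ disagreeWith? C′)) (allFin m)

  projections-atMost : AtMost (suc m) (InProjSup F z G X)
  projections-atMost = record
    { candidates = projections
    ; length≤    = s≤s (≤-reflexive (trans (length-map _ (allFin m)) (length-tabulate _)))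
    ; complete   = complete′
    }
    where
    complete′ : ∀ {S} → InProjSup F z G X S → S ∈ₗ projections
    complete′ {S} (σ , S≡Gσ) with any? (λ C′ → G⊇X? C′ ×-dec ¬? (satOn? σ C′))
    ... | no noneFalsified = here S≡G⊇X
      where
      S≡G⊇X : S ≡ tabulate (⌊_⌋ ∘ G⊇X?)
      S≡G⊇X = ⇔⇒≡ λ C → mk⇔
        (λ C∈S → from (∈-tabulate-⌊⌋ G⊇X? C) (proj₁ (to (S≡Gσ C) C∈S)))
        (λ C∈ → let C∈G⊇X = to (∈-tabulate-⌊⌋ G⊇X? C) C∈ in
                from (S≡Gσ C) (C∈G⊇X , decidable-stable (satOn? σ C)
                                         (λ ¬satC → noneFalsified (C , C∈G⊇X , ¬satC))))
    ... | yes (C′ , C′∈G⊇X , ¬satC′) =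
            there (subst (_∈ₗ _) (sym S≡disagreeWithC′) (∈-map⁺ _ (∈-allFin C′)))
      where
      S≡disagreeWithC′ : S ≡ tabulate (⌊_⌋ ∘ disagreeWith? C′)
      S≡disagreeWithC′ = ⇔⇒≡ λ C → mk⇔
        (λ C∈S → let (C∈G⊇X , satC) = to (S≡Gσ C) C∈S in
                 from (∈-tabulate-⌊⌋ (disagreeWith? C′) C)
                      (C∈G⊇X , λ C≈C′ → agreeOnX-falsified C≈C′ ¬satC′ satC))
        (λ C∈ → let (C∈G⊇X , C≉C′) = to (∈-tabulate-⌊⌋ (disagreeWith? C′) C) C∈ in
                from (S≡Gσ C) (C∈G⊇X , decidable-stable (satOn? σ C) λ ¬satC →
                                          C≉C′ (falsified⇒agreeOnX C∈G⊇X C′∈G⊇X ¬satC ¬satC′)))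

module _ {n m : ℕ} where

  selectedVars : List (Vertex n m) → List Bool → Subset n
  selectedVars (inj₁ x ∷ W) (true ∷ bs) = ⁅ x ⁆ ∪ selectedVars W bs
  selectedVars (_ ∷ W)      (_ ∷ bs)    = selectedVars W bs
  selectedVars _            _           = ∅

  ∈-selectedVars : ∀ (g : Vertex n m → Bool) W {x} →
                   x ∈ selectedVars W (map g W) ⇔ (inj₁ x ∈ₗ W × g (inj₁ x) ≡ true)
  ∈-selectedVars g [] = mk⇔ (⊥-elim ∘ ∉⊥) (λ ())
  ∈-selectedVars g (inj₂ C ∷ W) = mk⇔
    (λ x∈ → let (x∈W , gx) = to (∈-selectedVars g W) x∈ in there x∈W , gx)
    (λ { (here () , _) ; (there x∈W , gx) → from (∈-selectedVars g W) (x∈W , gx) })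
  ∈-selectedVars g (inj₁ y ∷ W) {x} with g (inj₁ y) in gy
  ... | true = mk⇔
    (λ x∈ → case x∈p∪q⁻ ⁅ y ⁆ _ x∈ of λ
       { (inj₁ x∈⁅y⁆) → case to x∈⁅y⁆⇔x≡y x∈⁅y⁆ of λ { refl → here refl , gy }
       ; (inj₂ x∈W)   → let (x∈W , gx) = to (∈-selectedVars g W) x∈W in there x∈W , gx })
    (λ { (here refl , _) → x∈p∪q⁺ (inj₁ (from x∈⁅y⁆⇔x≡y refl))
       ; (there x∈W , gx) → x∈p∪q⁺ (inj₂ (from (∈-selectedVars g W) (x∈W , gx))) })
  ... | false = mk⇔
    (λ x∈ → let (x∈W , gx) = to (∈-selectedVars g W) x∈ in there x∈W , gx)
    (λ { (here refl , gx) → case trans (sym gy) gx of λ ()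
       ; (there x∈W , gx) → from (∈-selectedVars g W) (x∈W , gx) })

_∈V?_ : ∀ {n m} v (L : List (Vertex n m)) → Dec (v ∈ₗ L)
v ∈V? L = Any.any? (v ≟V_) L

module _ {n m : ℕ} (F : CNF n m) where

  inClause?≡true⇔InClause : ∀ C x → inClause? F C x ≡ true ⇔ InClause F C x
  inClause?≡true⇔InClause C x with clause F C x
  ... | nothing = mk⇔ (λ ()) (λ x∉C → ⊥-elim (x∉C refl))
  ... | just _  = mk⇔ (λ _ ()) (λ _ → refl)

  occurs?≡true : ∀ {C x} → InClause F C x → occurs? F x ≡ true
  occurs?≡true {C} {x} x∈C = anyClause (allFin m) (∈-allFin C)
    where
    anyClause : ∀ Cs → C ∈ₗ Cs → foldr (λ D b → inClause? F D x ∨ b) false Cs ≡ true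
    anyClause (_ ∷ Cs) (here refl) rewrite from (inClause?≡true⇔InClause C x) x∈C = refl
    anyClause (D ∷ Cs) (there C∈Cs) rewrite anyClause Cs C∈Cs = Bool.∨-zeroʳ (inClause? F D x)

  var∈vertexList : ∀ {C x} → InClause F C x → inj₁ x ∈ₗ vertexList F
  var∈vertexList x∈C =
    ∈-++⁺ˡ (∈-map⁺ inj₁ (∈-filter⁺ (λ x → occurs? F x Bool.≟ true) (∈-allFin _) (occurs?≡true x∈C)))

  clause∈vertexList : ∀ C → inj₂ C ∈ₗ vertexList F
  clause∈vertexList C = ∈-++⁺ʳ _ (∈-map⁺ inj₂ (∈-allFin C))

  ∈-complement : ∀ {v} L → v ∈ₗ vertexList F → v ∈ₗ complement F L ⇔ v ∉ₗ L
  ∈-complement L v∈V = mk⇔ (proj₂ ∘ ∈-filter⁻ ∉L? {xs = vertexList F}) (∈-filter⁺ ∉L? v∈V)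
    where
    ∉L? = λ v → ¬? (v ∈V? L)

  ∈-complement² : ∀ {v} L → v ∈ₗ vertexList F → v ∈ₗ complement F (complement F L) ⇔ v ∈ₗ L
  ∈-complement² {v} L v∈V = mk⇔
    (λ v∈cc → decidable-stable (v ∈V? L)
                (λ v∉L → to (∈-complement _ v∈V) v∈cc (from (∈-complement L v∈V) v∉L)))
    (λ v∈L → from (∈-complement _ v∈V) (λ v∈c → to (∈-complement L v∈V) v∈c v∈L))

  ∈-selectedVars-adj : ∀ W C {x} →
    x ∈ selectedVars W (map (adj F (inj₂ C)) W) ⇔ (inj₁ x ∈ₗ W × InClause F C x)
  ∈-selectedVars-adj W C {x} =
    (⇔-id _ ×-⇔ inClause?≡true⇔InClause C x) ⇔-∘ ∈-selectedVars (adj F (inj₂ C)) W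

  -- The neighbourhood in complement F L of a clause in L depends only on its ≡-class, so
  -- sets that are such neighbourhoods number at most indexG F L.
  adjacencyClassCover : ∀ {k} {D : Subset n → Set} {P : Subset n → Subset m → Set}
    (L : List (Vertex n m)) → indexG F L ≤ k → Decidable D →
    (∀ X → D X → ∃ λ C → inj₂ C ∈ₗ L ×
                   (∀ x → x ∈ X ⇔ (inj₁ x ∈ₗ complement F L × InClause F C x))) →
    Cover k D P
  adjacencyClassCover {D = D} L index≤k D? neighbourhood = record
    { members  = filter D? (map (selectedVars W) classes)
    ; length≤  = ≤-trans (length-filter D? (map (selectedVars W) classes))
                         (≤-trans (≤-reflexive (length-map (selectedVars W) classes)) index≤k)
    ; sound    = all-filter D? (map (selectedVars W) classes)
    ; complete = λ X DX → inj₁ (∈-filter⁺ D? (selected X DX) DX)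
    }
    where
    W = complement F L
    classes = deduplicate (List.≡-dec Bool._≟_) (map (λ v → map (adj F v) W) L)
    selected : ∀ X → D X → X ∈ₗ map (selectedVars W) classes
    selected X DX with neighbourhood X DX
    ... | C , C∈L , X≡N[C] = subst (_∈ₗ map (selectedVars W) classes) (sym X≡)
          (∈-map⁺ (selectedVars W)
            (∈-deduplicate⁺ (List.≡-dec Bool._≟_) (∈-map⁺ (λ v → map (adj F v) W) C∈L)))
      where
      X≡ : X ≡ selectedVars W (map (adj F (inj₂ C)) W)
      X≡ = ⇔⇒≡ λ x → ⇔-sym (∈-selectedVars-adj W C) ⇔-∘ X≡N[C] x

_⇔-dec_ : ∀ {A B : Set} → Dec A → Dec B → Dec (A ⇔ B)
A? ⇔-dec B? =
  map′ (λ (f , g) → mk⇔ f g) (λ A⇔B → to A⇔B , from A⇔B) ((A? →-dec B?) ×-dec (B? →-dec A?))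

∈⇒≤foldr-⊔ : ∀ {a as} → a ∈ₗ as → a ≤ foldr _⊔_ 0 as
∈⇒≤foldr-⊔ {as = b ∷ as} (here refl) = m≤m⊔n b _
∈⇒≤foldr-⊔ {as = b ∷ as} (there a∈as) = ≤-trans (∈⇒≤foldr-⊔ a∈as) (m≤n⊔m b _)

⊑⇒≡⊎∈nonRootNodes : ∀ {n m} {z T : Tree n m} → z ⊑ T → z ≡ T ⊎ z ∈ₗ nonRootNodes T
⊑⇒≡⊎∈nonRootNodes here = inj₁ refl
⊑⇒≡⊎∈nonRootNodes (left z⊑l) with ⊑⇒≡⊎∈nonRootNodes z⊑l
... | inj₁ refl = inj₂ (here refl)
... | inj₂ z∈ = inj₂ (there (there (∈-++⁺ˡ z∈)))
⊑⇒≡⊎∈nonRootNodes (right {l = l} z⊑r) with ⊑⇒≡⊎∈nonRootNodes z⊑r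
... | inj₁ refl = inj₂ (there (here refl))
... | inj₂ z∈ = inj₂ (there (there (∈-++⁺ʳ (nonRootNodes l) z∈)))

module _ {n m : ℕ} (F : CNF n m) where

  ι≤treeIndex : ∀ {z T} → z ∈ₗ nonRootNodes T → ι F (leaves z) ≤ treeIndex F T
  ι≤treeIndex z∈ = ∈⇒≤foldr-⊔ (∈-map⁺ (λ z → ι F (leaves z)) z∈)

  module _ (z : Tree n m) where

    fz? : Decidable (FZ F z)
    fz? C = inj₂ C ∈V? leaves z

    xUp? : Decidable (XUp F z)
    xUp? X = any? λ C → ¬? (fz? C) ×-dec
               all? λ x → (x ∈? X) ⇔-dec ((inj₁ x ∈V? leaves z) ×-dec inClause-dec F C x)

    xDown? : Decidable (XDown F z)
    xDown? Y = any? λ C → fz? C ×-dec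
                 all? λ x → (x ∈? Y) ⇔-dec
                              ((occurs-dec x ×-dec ¬? (inj₁ x ∈V? leaves z)) ×-dec inClause-dec F C x)
      where
      occurs-dec : Decidable (Occurs F)
      occurs-dec x = any? λ C → inClause-dec F C x

    upCover : ∀ {k} {P : Subset n → Subset m → Set} → ι F (leaves z) ≤ k → Cover k (XUp F z) P
    upCover ι≤k =
      adjacencyClassCover F (complement F L) (≤-trans (m≤n⊔m _ _) ι≤k) xUp? neighbourhood
      where
      L = leaves z
      neighbourhood : ∀ X → XUp F z X → ∃ λ C → inj₂ C ∈ₗ complement F L ×
        (∀ x → x ∈ X ⇔ (inj₁ x ∈ₗ complement F (complement F L) × InClause F C x))
      neighbourhood X (C , C∉L , X⇔) =
        C , from (∈-complement F L (clause∈vertexList F C)) C∉L , λ x → mk⇔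
          (λ x∈X → let (x∈L , x∈C) = to (X⇔ x) x∈X in
                   from (∈-complement² F L (var∈vertexList F x∈C)) x∈L , x∈C)
          (λ (x∈∁∁L , x∈C) → from (X⇔ x) (to (∈-complement² F L (var∈vertexList F x∈C)) x∈∁∁L , x∈C))

    downCover : ∀ {k} {P : Subset n → Subset m → Set} → ι F (leaves z) ≤ k → Cover k (XDown F z) P
    downCover ι≤k = adjacencyClassCover F L (≤-trans (m≤m⊔n _ _) ι≤k) xDown? neighbourhood
      where
      L = leaves z
      neighbourhood : ∀ Y → XDown F z Y → ∃ λ C → inj₂ C ∈ₗ L ×
        (∀ x → x ∈ Y ⇔ (inj₁ x ∈ₗ complement F L × InClause F C x))
      neighbourhood Y (C , C∈L , Y⇔) = C , C∈L , λ x → mk⇔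
        (λ x∈Y → let ((_ , x∉L) , x∈C) = to (Y⇔ x) x∈Y in
                 from (∈-complement F L (var∈vertexList F x∈C)) x∉L , x∈C)
        (λ (x∈∁L , x∈C) →
           from (Y⇔ x) (((C , x∈C) , to (∈-complement F L (var∈vertexList F x∈C)) x∈∁L) , x∈C))

  module _ {T : Tree n m} (decomp : IsDecompTree F T) where

    rootUpCover : ∀ {k} {P : Subset n → Subset m → Set} → Cover k (XUp F T) P
    rootUpCover = record
      { members = [] ; length≤ = z≤n ; sound = []
      ; complete = λ { X (C , C∉T , _) → ⊥-elim (C∉T (from (proj₂ decomp (inj₂ C)) tt)) }
      }

    -- Every Y ∈ 𝒳↓ at the root is empty, and no clause is satisfied on the empty set.
    rootDownCover : ∀ {k} {G : Fin m → Set} → Cover k (XDown F T) (InProjSup F T G)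
    rootDownCover = record
      { members = [] ; length≤ = z≤n ; sound = []
      ; complete = λ { Y (_ , _ , Y⇔) → inj₂ λ { S (σ , S⇔) (C , C∈S) →
          let (_ , x , x∈Y , _) = to (S⇔ C) C∈S
              ((x∈F , x∉T) , _) = to (Y⇔ x) x∈Y
          in x∉T (from (proj₂ decomp (inj₁ x)) x∈F) } }
      }

    nodeCovers : ∀ {z} → z ⊑ T → ∀ {P : Subset n → Subset m → Set} {G : Fin m → Set} →
      Cover (treeIndex F T) (XUp F z) P × Cover (treeIndex F T) (XDown F z) (InProjSup F z G)
    nodeCovers {z} z⊑T with ⊑⇒≡⊎∈nonRootNodes z⊑T
    ... | inj₁ refl = rootUpCover , rootDownCover
    ... | inj₂ z∈ = upCover z (ι≤treeIndex z∈) , downCover z (ι≤treeIndex z∈)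

restrictedShapes-atMost : ∀ {n m k} (F : CNF n m) (z : Tree n m) →
  Cover k (XUp F z) (InProjSup F z (λ C → ¬ FZ F z C)) ×
  Cover k (XDown F z) (InProjSup F z (FZ F z)) →
  AtMost (suc m ^ (2 * k)) (RestrictedShape F z)
restrictedShapes-atMost {m = m} {k} F z (up , down) =
  AtMost-weaken (≤-reflexive square≡^2*)
    (AtMost-⊆ asPair
      (AtMost-map₂ _,_ (unions-atMost F z up (Projection.projections-atMost F z (¬? ∘ fz? F z)))
                       (unions-atMost F z down (Projection.projections-atMost F z (fz? F z)))))
  where
  open ≡-Reasoning
  square≡^2* : suc m ^ k * suc m ^ k ≡ suc m ^ (2 * k)
  square≡^2* = begin
    suc m ^ k * suc m ^ k        ≡⟨ cong (λ j → suc m ^ k * suc m ^ j) (sym (+-identityʳ k)) ⟩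
    suc m ^ k * suc m ^ (k + 0)  ≡⟨ sym (^-distribˡ-+-* (suc m) k (k + 0)) ⟩
    suc m ^ (2 * k)              ∎
  asPair : ∀ {s} → RestrictedShape F z s →
           ∃₂ λ out inn → Unions F z (XUp F z) (InProjSup F z (λ C → ¬ FZ F z C)) out ×
                          Unions F z (XDown F z) (InProjSup F z (FZ F z)) inn × s ≡ (out , inn)
  asPair {out , inn} (_ , _ , outUnion , inUnion) = out , inn , outUnion , inUnion , refl

corollary4 : ∀ {n m} (F : CNF n m) (T : Tree n m) → IsDecompTree F T →
    ∀ z → z ⊑ T →
    (shapes : List (Subset m × Subset m)) → Unique shapes →
    All (RestrictedShape F z) shapes →
    length shapes ≤ suc m ^ (2 * treeIndex F T)
corollary4 F T decomp z z⊑T shapes unique restricted =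
  atMost⇒length≤ (restrictedShapes-atMost F z (nodeCovers F decomp z⊑T)) unique restricted
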